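{- For every positive integer $n$ and every edge $e$ of the complete graph $K_{2n+1}$, $def(K_{2n+1}-e)=n-1$.
   Context: All graphs are finite, undirected, without loops or multiple edges. A proper $t$-edge-coloring of $G$ is a map $\alpha:E(G)\to\{1,\ldots,t\}$ such that all $t$ colors are used and adjacent edges receive different colors. The spectrum $S(v,\alpha)$ of a vertex $v$ is the set of colors on edges incident to $v$. For a finite set $A$ of integers, $def(A)=\max A-\min A-|A|+1$. Define $def(v,\alpha)=def(S(v,\alpha))$, $def(G,\alpha)=\sum_{v\in V(G)}def(v,\alpha)$, and $def(G)=\min_\alpha def(G,\alpha)$ over all proper edge-colorings $\alpha$ of $G$. $K_{2n+1}-e$ denotes the complete graph on $2n+1$ vertices with one edge removed. -}

module Defs where

open import Data.Nat using (ℕ; zero; suc; _+_; _∸_; _≤_; _⊔_; _⊓_)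
open import Data.Nat.Properties using (_≟_)
open import Data.Bool using (Bool; true; false; not; _∧_; _∨_)
open import Data.Fin using (Fin)
import Data.Fin.Properties as FinP
open import Data.List using (List; []; _∷_; length; filter; map; allFin; deduplicate)
open import Data.Nat.ListAction using (sum)
open import Data.Product using (Σ; _×_; ∃; ∃-syntax)
open import Relation.Binary.PropositionalEquality using (_≡_; _≢_)
open import Relation.Nullary.Decidable using (⌊_⌋)

Graph : ℕ → Set
Graph m = Fin m → Fin m → Bool

IsSimple : ∀ {m} → Graph m → Set
IsSimple {m} G = (∀ i j → G i j ≡ G j i) × (∀ i → G i i ≡ false)

KminusE : ∀ {m} → Fin m → Fin m → Graph m
KminusE u v i j =
  not ⌊ i FinP.≟ j ⌋ ∧
  not ((⌊ i FinP.≟ u ⌋ ∧ ⌊ j FinP.≟ v ⌋) ∨ (⌊ i FinP.≟ v ⌋ ∧ ⌊ j FinP.≟ u ⌋))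

-- An edge-colouring assigns a colour α i j to each ordered pair; only the
-- values on edges matter, and they must agree for (i , j) and (j , i).
Coloring : ℕ → Set
Coloring m = Fin m → Fin m → ℕ

IsProperTColoring : ∀ {m} → Graph m → ℕ → Coloring m → Set
IsProperTColoring {m} G t α =
  (∀ i j → G i j ≡ true → α i j ≡ α j i) ×
  (∀ i j → G i j ≡ true → (1 ≤ α i j) × (α i j ≤ t)) ×
  (∀ c → 1 ≤ c → c ≤ t → ∃[ i ] ∃[ j ] (G i j ≡ true × α i j ≡ c)) ×
  (∀ i j k → G i j ≡ true → G i k ≡ true → j ≢ k → α i j ≢ α i k)

-- Spectrum S(v, α) as a list (possibly with repetitions) of colours on
-- edges incident to v.
spectrumList : ∀ {m} → Graph m → Coloring m → Fin m → List ℕ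
spectrumList G α v = map (α v) (filter (λ w → G v w Data.Bool.≟ true) (allFin _))

maxL : List ℕ → ℕ
maxL []       = 0
maxL (x ∷ xs) = x ⊔ maxL xs

minL : List ℕ → ℕ
minL []       = 0
minL (x ∷ []) = x
minL (x ∷ y ∷ xs) = x ⊓ minL (y ∷ xs)

card : List ℕ → ℕ
card xs = length (deduplicate _≟_ xs)

-- def(A) = max A - min A - |A| + 1  (always ≥ 0 for nonempty A, so truncated
-- subtraction is exact); def(∅) := 0 (does not occur in the theorem).
defSet : List ℕ → ℕ
defSet []         = 0
defSet xs@(_ ∷ _) = (maxL xs + 1) ∸ (minL xs + card xs)

defVertex : ∀ {m} → Graph m → Coloring m → Fin m → ℕ
defVertex G α v = defSet (spectrumList G α v)

defGraphCol : ∀ {m} → Graph m → Coloring m → ℕ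
defGraphCol G α = sum (map (defVertex G α) (allFin _))

IsDeficiency : ∀ {m} → Graph m → ℕ → Set
IsDeficiency {m} G d =
  (∃[ t ] ∃[ α ] (IsProperTColoring G t α × defGraphCol G α ≡ d)) ×
  (∀ t α → IsProperTColoring G t α → d ≤ defGraphCol G α)

-- Lower bound. Let k = 2n, the maximum degree, and for a vertex w and a residue ρ modulo k let
-- c_ρ(w) be the number of colours at w congruent to ρ. The colours at w below min S(w) + k
-- have distinct residues and the others fill at most def(w) places, which gives
-- ∑_ρ |c_ρ(w) − 1| + deg w ≤ 2 def(w) + k. For each ρ the edges with colour ≡ ρ form a graph
-- on the odd number 2n + 1 of vertices, so c_ρ(w) ≠ 1 for some w. Summing over ρ and w,
-- k + ∑_w deg w ≤ 2 def + (2n + 1) k, and as K_{2n+1} − e has degree sum (2n + 1) k − 2 this is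
-- k ≤ 2 def + 2, i.e. def ≥ n − 1.
-- Upper bound. An explicit colouring in which all vertices but one have interval spectra and the
-- last one misses n − 1 colours.

module Submission where

open import Defs
open import Data.Nat using (ℕ; _+_; _*_; _∸_; _≤_)
open import Data.Fin using (Fin)
open import Relation.Binary.PropositionalEquality using (_≢_)

open import Data.Bool as Bool using (Bool; true; false; not; _∧_; _∨_)
open import Data.Bool.Properties using (∧-comm; ∨-comm; ∧-zeroʳ)
open import Data.Empty using (⊥; ⊥-elim)
open import Data.Fin as Fin using (zero; suc; toℕ; fromℕ<)
import Data.Fin.Permutation.Components as PC
open import Data.Fin.Permutation using (Permutation′; _⟨$⟩ʳ_; _⟨$⟩ˡ_; inverseˡ; inverseʳ; transpose; _∘ₚ_)
import Data.Fin.Properties as Finₚ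
open import Data.List using (List; []; _∷_; length; map; filter; tabulate; allFin; deduplicate)
open import Data.List.Properties using (length-map; filter-all; map-∘)
open import Data.List.Relation.Unary.All as All using (All; []; _∷_)
import Data.List.Relation.Unary.All.Properties as Allₚ
open import Data.List.Relation.Unary.AllPairs using ([]; _∷_)
open import Data.List.Relation.Unary.Unique.Propositional using (Unique)
import Data.List.Relation.Unary.Unique.Propositional.Properties as Uniqueₚ
open import Data.Nat as ℕ using (zero; suc; _<_; z≤n; s≤s; NonZero; ∣_-_∣; _⊓_; _<?_; _≤?_)
open import Data.Nat.DivMod using (_%_; _/_; m%n<n; m≡m%n+[m/n]*n)
import Data.Nat.ListAction as ListAction
open import Data.Nat.Properties
open import Algebra.Properties.Semiring.Sum +-*-semiring
  using (sum; sum-syntax; sum-replicate-zero; sum-cong-≗; ∑-distrib-+; ∑-comm; *-distribˡ-sum)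
open import Data.Nat.Solver using (module +-*-Solver)
open import Data.Product using (∃-syntax; _×_; _,_; proj₁; proj₂)
open import Data.Unit using (⊤; tt)
open import Function using (_∘_)
open import Level using (0ℓ)
open import Relation.Binary.Definitions using (tri<; tri≈; tri>)
open import Relation.Binary.PropositionalEquality
open import Relation.Nullary using (Dec; yes; no; ¬_; ¬?; contradiction)
open import Relation.Nullary.Decidable using (⌊_⌋; isYes≗does; dec-true; dec-false; decidable-stable)
open import Relation.Unary using (Pred; Decidable)

⌊⌋≡true : ∀ {P : Set} (P? : Dec P) → P → ⌊ P? ⌋ ≡ true
⌊⌋≡true P? p = trans (isYes≗does P?) (dec-true P? p)

⌊⌋≡false : ∀ {P : Set} (P? : Dec P) → ¬ P → ⌊ P? ⌋ ≡ false
⌊⌋≡false P? ¬p = trans (isYes≗does P?) (dec-false P? ¬p)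

⌊⌋∧⌊⌋≡false : ∀ {P Q : Set} (P? : Dec P) (Q? : Dec Q) → ¬ (P × Q) → ⌊ P? ⌋ ∧ ⌊ Q? ⌋ ≡ false
⌊⌋∧⌊⌋≡false (yes p) Q? ¬pq = ⌊⌋≡false Q? (λ q → ¬pq (p , q))
⌊⌋∧⌊⌋≡false (no _)  _  _   = refl

∑-mono-≤ : ∀ {n} {f g : Fin n → ℕ} → (∀ i → f i ≤ g i) → sum f ≤ sum g
∑-mono-≤ {zero}  _   = z≤n
∑-mono-≤ {suc n} f≤g = +-mono-≤ (f≤g zero) (∑-mono-≤ (f≤g ∘ suc))

∑-const : ∀ n c → ∑[ i < n ] c ≡ n * c
∑-const zero    c = refl
∑-const (suc n) c = cong (c +_) (∑-const n c)

∑≡0⇒≡0 : ∀ {n} (f : Fin n → ℕ) → sum f ≡ 0 → ∀ i → f i ≡ 0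
∑≡0⇒≡0 f ∑f≡0 zero    = m+n≡0⇒m≡0 (f zero) ∑f≡0
∑≡0⇒≡0 f ∑f≡0 (suc i) = ∑≡0⇒≡0 (f ∘ suc) (m+n≡0⇒n≡0 (f zero) ∑f≡0) i

∑-single : ∀ {n} (f : Fin n → ℕ) i → (∀ j → j ≢ i → f j ≡ 0) → sum f ≡ f i
∑-single {suc n} f zero others≡0 = begin
  f zero + ∑[ j < n ] f (suc j) ≡⟨ cong (f zero +_) (sum-cong-≗ (λ j → others≡0 (suc j) λ ())) ⟩
  f zero + ∑[ j < n ] 0         ≡⟨ cong (f zero +_) (sum-replicate-zero n) ⟩
  f zero + 0                    ≡⟨ +-identityʳ (f zero) ⟩
  f zero                        ∎
  where open ≡-Reasoning
∑-single {suc n} f (suc i) others≡0 =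
  trans (cong (_+ sum (f ∘ suc)) (others≡0 zero λ ()))
        (∑-single (f ∘ suc) i (λ j j≢i → others≡0 (suc j) (j≢i ∘ Finₚ.suc-injective)))

indicator : Bool → ℕ
indicator true  = 1
indicator false = 0

count : ∀ {n} → (Fin n → Bool) → ℕ
count {n} p = ∑[ i < n ] indicator (p i)

count-cong : ∀ {n} {p q : Fin n → Bool} → (∀ i → p i ≡ q i) → count p ≡ count q
count-cong p≗q = sum-cong-≗ (cong indicator ∘ p≗q)

count+count-not : ∀ {n} (p : Fin n → Bool) → count p + count (not ∘ p) ≡ n
count+count-not {n} p = begin
  count p + count (not ∘ p)                            ≡⟨ ∑-distrib-+ (indicator ∘ p) (indicator ∘ not ∘ p) ⟨
  ∑[ i < n ] (indicator (p i) + indicator (not (p i))) ≡⟨ sum-cong-≗ (λ i → partition (p i)) ⟩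
  ∑[ i < n ] 1                                         ≡⟨ ∑-const n 1 ⟩
  n * 1                                                ≡⟨ *-identityʳ n ⟩
  n                                                    ∎
  where
  open ≡-Reasoning
  partition : ∀ b → indicator b + indicator (not b) ≡ 1
  partition true  = refl
  partition false = refl

count-∨-disjoint : ∀ {n} (p q : Fin n → Bool) → (∀ i → p i ∧ q i ≡ false) →
                   count (λ i → p i ∨ q i) ≡ count p + count q
count-∨-disjoint p q disjoint =
  trans (sum-cong-≗ (λ i → indicator-∨ (p i) (q i) (disjoint i))) (∑-distrib-+ (indicator ∘ p) (indicator ∘ q))
  where
  indicator-∨ : ∀ a b → a ∧ b ≡ false → indicator (a ∨ b) ≡ indicator a + indicator b
  indicator-∨ true  true  ()
  indicator-∨ true  false _ = refl
  indicator-∨ false _     _ = refl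

count-≡ : ∀ {n} (a : Fin n) → count (λ i → ⌊ i Fin.≟ a ⌋) ≡ 1
count-≡ a = trans (∑-single _ a (λ j j≢a → cong indicator (⌊⌋≡false (j Fin.≟ a) j≢a)))
                  (cong indicator (⌊⌋≡true (a Fin.≟ a) refl))

multiplicity : ℕ → List ℕ → ℕ
multiplicity c []       = 0
multiplicity c (x ∷ xs) = indicator ⌊ x ℕ.≟ c ⌋ + multiplicity c xs

multiplicity-absent : ∀ c xs → All (c ≢_) xs → multiplicity c xs ≡ 0
multiplicity-absent c []       []             = refl
multiplicity-absent c (x ∷ xs) (c≢x ∷ c∉xs)
  rewrite ⌊⌋≡false (x ℕ.≟ c) (c≢x ∘ sym) = multiplicity-absent c xs c∉xs

multiplicity-unique : ∀ c xs → Unique xs → multiplicity c xs ≤ 1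
multiplicity-unique c []       []           = z≤n
multiplicity-unique c (x ∷ xs) (x∉xs ∷ !xs) with x ℕ.≟ c
... | yes refl = ≤-reflexive (cong suc (multiplicity-absent x xs x∉xs))
... | no  _    = multiplicity-unique c xs !xs

multiplicity-filter-≤ : ∀ {A : Set} {P : Pred A 0ℓ} (P? : Decidable P) (f : A → ℕ) c xs →
                        multiplicity c (map f (filter P? xs)) ≤ multiplicity c (map f xs)
multiplicity-filter-≤ P? f c []       = z≤n
multiplicity-filter-≤ P? f c (x ∷ xs) with P? x
... | yes _ = +-monoʳ-≤ (indicator ⌊ f x ℕ.≟ c ⌋) (multiplicity-filter-≤ P? f c xs)
... | no  _ = ≤-trans (multiplicity-filter-≤ P? f c xs) (m≤n+m _ _)

∑-indicator-window : ∀ lo d y → lo ≤ y → y < lo + d → ∑[ c < d ] indicator ⌊ y ℕ.≟ lo + toℕ c ⌋ ≡ 1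
∑-indicator-window lo d y lo≤y y<lo+d = begin
  ∑[ c < d ] indicator ⌊ y ℕ.≟ lo + toℕ c ⌋ ≡⟨ ∑-single {d} _ i (λ j j≢i → cong indicator (⌊⌋≡false (y ℕ.≟ lo + toℕ j) (j≢i ∘ at-i))) ⟩
  indicator ⌊ y ℕ.≟ lo + toℕ i ⌋            ≡⟨ cong indicator (⌊⌋≡true (y ℕ.≟ _) (sym lo+i≡y)) ⟩
  1                                          ∎
  where
  open ≡-Reasoning
  y-lo<d : y ∸ lo < d
  y-lo<d = subst (y ∸ lo <_) (m+n∸m≡n lo d) (∸-monoˡ-< y<lo+d lo≤y)
  i = fromℕ< y-lo<d
  lo+i≡y : lo + toℕ i ≡ y
  lo+i≡y = trans (cong (lo +_) (Finₚ.toℕ-fromℕ< y-lo<d)) (m+[n∸m]≡n lo≤y)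
  at-i : ∀ {j} → y ≡ lo + toℕ j → j ≡ i
  at-i y≡lo+j = Finₚ.toℕ-injective (+-cancelˡ-≡ lo _ _ (trans (sym y≡lo+j) (sym lo+i≡y)))

∑-multiplicity : ∀ lo d ys → All (λ y → lo ≤ y × y < lo + d) ys →
                 ∑[ c < d ] multiplicity (lo + toℕ c) ys ≡ length ys
∑-multiplicity lo d []       []                     = sum-replicate-zero d
∑-multiplicity lo d (y ∷ ys) ((lo≤y , y<lo+d) ∷ ys∈) =
  trans (∑-distrib-+ {d} (λ c → indicator ⌊ y ℕ.≟ lo + toℕ c ⌋) (λ c → multiplicity (lo + toℕ c) ys))
        (cong₂ _+_ (∑-indicator-window lo d y lo≤y y<lo+d) (∑-multiplicity lo d ys ys∈))

length-unique-≤ : ∀ lo hi ys → Unique ys → All (λ y → lo ≤ y × y < hi) ys → length ys ≤ hi ∸ lo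
length-unique-≤ lo hi []           _   _                         = z≤n
length-unique-≤ lo hi ys@(_ ∷ _) !ys ys∈@((lo≤y , y<hi) ∷ _) = begin
  length ys                               ≡⟨ ∑-multiplicity lo d ys (All.map widen ys∈) ⟨
  ∑[ c < d ] multiplicity (lo + toℕ c) ys ≤⟨ ∑-mono-≤ {d} (λ c → multiplicity-unique (lo + toℕ c) ys !ys) ⟩
  ∑[ c < d ] 1                            ≡⟨ ∑-const d 1 ⟩
  d * 1                                   ≡⟨ *-identityʳ d ⟩
  d                                       ∎
  where
  open ≤-Reasoning
  d = hi ∸ lo
  lo+d≡hi : lo + d ≡ hi
  lo+d≡hi = m+[n∸m]≡n (≤-trans lo≤y (<⇒≤ y<hi))
  widen : ∀ {y} → lo ≤ y × y < hi → lo ≤ y × y < lo + d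
  widen (lo≤y , y<hi) = lo≤y , subst (_ <_) (sym lo+d≡hi) y<hi

length-filter-split : ∀ {A : Set} {P : Pred A 0ℓ} (P? : Decidable P) xs →
                      length (filter P? xs) + length (filter (¬? ∘ P?) xs) ≡ length xs
length-filter-split P? []       = refl
length-filter-split P? (x ∷ xs) with P? x
... | yes _ = cong suc (length-filter-split P? xs)
... | no  _ = trans (+-suc _ _) (cong suc (length-filter-split P? xs))

Unique-map⁺-injectiveOn : ∀ {A B : Set} {P : A → Set} (f : A → B) →
                          (∀ {x y} → P x → P y → f x ≡ f y → x ≡ y) →
                          ∀ {xs} → All P xs → Unique xs → Unique (map f xs)
Unique-map⁺-injectiveOn f inj {[]}     []         []           = []
Unique-map⁺-injectiveOn {P = P} f inj {x ∷ xs} (px ∷ pxs) (x∉xs ∷ !xs) =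
  Allₚ.map⁺ (images-distinct pxs x∉xs) ∷ Unique-map⁺-injectiveOn f inj pxs !xs
  where
  images-distinct : ∀ {ys} → All P ys → All (x ≢_) ys → All (λ y → f x ≢ f y) ys
  images-distinct []         []           = []
  images-distinct (py ∷ pys) (x≢y ∷ x∉ys) = (x≢y ∘ inj px py) ∷ images-distinct pys x∉ys

maxL-upper : ∀ xs → All (_≤ maxL xs) xs
maxL-upper []       = []
maxL-upper (x ∷ xs) = m≤m⊔n x (maxL xs) ∷ All.map (λ y≤ → ≤-trans y≤ (m≤n⊔m x (maxL xs))) (maxL-upper xs)

maxL-least : ∀ {b} xs → All (_≤ b) xs → maxL xs ≤ b
maxL-least []       []            = z≤n
maxL-least (x ∷ xs) (x≤b ∷ xs≤b) = ⊔-lub x≤b (maxL-least xs xs≤b)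

minL-lower : ∀ xs → All (minL xs ≤_) xs
minL-lower []                 = []
minL-lower (x ∷ [])           = ≤-refl ∷ []
minL-lower (x ∷ xs@(_ ∷ _)) = m⊓n≤m x (minL xs) ∷ All.map (≤-trans (m⊓n≤n x (minL xs))) (minL-lower xs)

minL-greatest : ∀ {a} x xs → All (a ≤_) (x ∷ xs) → a ≤ minL (x ∷ xs)
minL-greatest x []       (a≤x ∷ [])   = a≤x
minL-greatest x (y ∷ ys) (a≤x ∷ a≤ys) = ⊓-glb a≤x (minL-greatest y ys a≤ys)

deduplicate-unique : ∀ {xs} → Unique xs → deduplicate ℕ._≟_ xs ≡ xs
deduplicate-unique {[]}     []           = refl
deduplicate-unique {x ∷ xs} (x∉xs ∷ !xs) rewrite deduplicate-unique !xs =
  cong (x ∷_) (filter-all (¬? ∘ (x ℕ.≟_)) x∉xs)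

defSet-unique : ∀ {x xs} → Unique (x ∷ xs) →
                defSet (x ∷ xs) ≡ (maxL (x ∷ xs) + 1) ∸ (minL (x ∷ xs) + length (x ∷ xs))
defSet-unique {x} {xs} !xs =
  cong (λ c → (maxL (x ∷ xs) + 1) ∸ (minL (x ∷ xs) + c)) (cong length (deduplicate-unique !xs))

defSet-≤ : ∀ {a b} xs → Unique xs → All (λ y → a ≤ y × y ≤ b) xs → defSet xs ≤ (b + 1) ∸ (a + length xs)
defSet-≤ []       _   _  = z≤n
defSet-≤ (x ∷ xs) !xs xs∈ rewrite defSet-unique !xs =
  ∸-mono (+-monoˡ-≤ 1 (maxL-least (x ∷ xs) (All.map proj₂ xs∈)))
         (+-monoˡ-≤ (length (x ∷ xs)) (minL-greatest x xs (All.map proj₁ xs∈)))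

%-≡∧/-<⇒+-≤ : ∀ k .{{_ : NonZero k}} {x y} → x % k ≡ y % k → x / k < y / k → x + k ≤ y
%-≡∧/-<⇒+-≤ k {x} {y} x%≡y% x/<y/ = begin
  x + k                   ≡⟨ cong (_+ k) (m≡m%n+[m/n]*n x k) ⟩
  x % k + (x / k) * k + k ≡⟨ +-assoc (x % k) _ k ⟩
  x % k + ((x / k) * k + k) ≡⟨ cong (x % k +_) (+-comm _ k) ⟩
  x % k + suc (x / k) * k ≤⟨ +-mono-≤ (≤-reflexive x%≡y%) (*-monoˡ-≤ k x/<y/) ⟩
  y % k + (y / k) * k     ≡⟨ m≡m%n+[m/n]*n y k ⟨
  y                       ∎
  where open ≤-Reasoning

%-injective-window : ∀ k .{{_ : NonZero k}} {a x y} → a ≤ x → x < a + k → a ≤ y → y < a + k →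
                     x % k ≡ y % k → x ≡ y
%-injective-window k {a} {x} {y} a≤x x<a+k a≤y y<a+k x%≡y% with <-cmp (x / k) (y / k)
... | tri< x/<y/ _ _ = ⊥-elim (<⇒≱ y<a+k (≤-trans (+-monoˡ-≤ k a≤x) (%-≡∧/-<⇒+-≤ k x%≡y% x/<y/)))
... | tri> _ _ y/<x/ = ⊥-elim (<⇒≱ x<a+k (≤-trans (+-monoˡ-≤ k a≤y) (%-≡∧/-<⇒+-≤ k (sym x%≡y%) y/<x/)))
... | tri≈ _ x/≡y/ _ = begin
  x                   ≡⟨ m≡m%n+[m/n]*n x k ⟩
  x % k + (x / k) * k ≡⟨ cong₂ (λ r q → r + q * k) x%≡y% x/≡y/ ⟩
  y % k + (y / k) * k ≡⟨ m≡m%n+[m/n]*n y k ⟨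
  y                   ∎
  where open ≡-Reasoning

module _ (k : ℕ) .{{_ : NonZero k}} where

  residueCount : List ℕ → Fin k → ℕ
  residueCount xs ρ = multiplicity (toℕ ρ) (map (_% k) xs)

  residuesHit : List ℕ → ℕ
  residuesHit xs = ∑[ ρ < k ] (residueCount xs ρ ⊓ 1)

  ∑-residueCount : ∀ xs → ∑[ ρ < k ] residueCount xs ρ ≡ length xs
  ∑-residueCount xs =
    trans (∑-multiplicity 0 k (map (_% k) xs) (Allₚ.map⁺ (All.universal (λ x → z≤n , m%n<n x k) xs)))
          (length-map (_% k) xs)

  length≤defSet+residuesHit : ∀ xs → Unique xs → length xs ≤ k → length xs ≤ defSet xs + residuesHit xs
  length≤defSet+residuesHit []            _   _     = z≤n
  length≤defSet+residuesHit xs@(_ ∷ _) !xs len≤k = begin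
    length xs                  ≡⟨ length-filter-split (_<? a + k) xs ⟨
    length low + length high   ≤⟨ +-mono-≤ low≤hit high≤def ⟩
    residuesHit xs + defSet xs ≡⟨ +-comm (residuesHit xs) (defSet xs) ⟩
    defSet xs + residuesHit xs ∎
    where
    open ≤-Reasoning
    a = minL xs
    b = maxL xs
    low  = filter (_<? a + k) xs
    high = filter (¬? ∘ (_<? a + k)) xs
    low-window : All (λ y → a ≤ y × y < a + k) low
    low-window = All.zip (Allₚ.filter⁺ (_<? a + k) (minL-lower xs) , Allₚ.all-filter (_<? a + k) xs)
    low≤hit : length low ≤ residuesHit xs
    low≤hit = begin
      length low                    ≡⟨ ∑-residueCount low ⟨
      ∑[ ρ < k ] residueCount low ρ ≤⟨ ∑-mono-≤ {k} (λ ρ → ⊓-glb (multiplicity-filter-≤ (_<? a + k) (_% k) (toℕ ρ) xs)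
                                                              (multiplicity-unique (toℕ ρ) _ !residues)) ⟩
      residuesHit xs                ∎
      where
      !residues : Unique (map (_% k) low)
      !residues = Unique-map⁺-injectiveOn (_% k)
        (λ (a≤x , x<a+k) (a≤y , y<a+k) → %-injective-window k a≤x x<a+k a≤y y<a+k)
        low-window (Uniqueₚ.filter⁺ (_<? a + k) !xs)
    high-window : All (λ y → a + k ≤ y × y < b + 1) high
    high-window = All.zip ( All.map ≮⇒≥ (Allₚ.all-filter (¬? ∘ (_<? a + k)) xs)
                          , Allₚ.filter⁺ (¬? ∘ (_<? a + k)) (All.map y≤b⇒y<b+1 (maxL-upper xs)))
      where y≤b⇒y<b+1 : ∀ {y} → y ≤ b → y < b + 1
            y≤b⇒y<b+1 {y} y≤b = subst (y <_) (+-comm 1 b) (s≤s y≤b)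
    high≤def : length high ≤ defSet xs
    high≤def = begin
      length high               ≤⟨ length-unique-≤ (a + k) (b + 1) high (Uniqueₚ.filter⁺ (¬? ∘ (_<? a + k)) !xs) high-window ⟩
      (b + 1) ∸ (a + k)         ≤⟨ ∸-monoʳ-≤ (b + 1) (+-monoʳ-≤ a len≤k) ⟩
      (b + 1) ∸ (a + length xs) ≡⟨ defSet-unique !xs ⟨
      defSet xs                 ∎

  ∑∣residueCount-1∣ : ∀ xs → Unique xs → length xs ≤ k →
                      ∑[ ρ < k ] ∣ residueCount xs ρ - 1 ∣ + length xs ≤ 2 * defSet xs + k
  ∑∣residueCount-1∣ xs !xs len≤k = +-cancelʳ-≤ (H + H) _ _ (begin
    S + L + (H + H)       ≡⟨ solve 3 (λ S L H → S :+ L :+ (H :+ H) := S :+ (H :+ H) :+ L) refl S L H ⟩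
    S + (H + H) + L       ≡⟨ cong (_+ L) S+2H≡L+k ⟩
    L + k + L             ≤⟨ +-mono-≤ (+-monoˡ-≤ k L≤d+H) L≤d+H ⟩
    d + H + k + (d + H)   ≡⟨ solve 3 (λ d H k → d :+ H :+ k :+ (d :+ H) := con 2 :* d :+ k :+ (H :+ H)) refl d H k ⟩
    2 * d + k + (H + H)   ∎)
    where
    open ≤-Reasoning
    open +-*-Solver
    c = residueCount xs
    S = ∑[ ρ < k ] ∣ c ρ - 1 ∣
    L = length xs
    H = residuesHit xs
    d = defSet xs
    L≤d+H : L ≤ d + H
    L≤d+H = length≤defSet+residuesHit xs !xs len≤k
    ∣c-1∣+2[c⊓1]≡c+1 : ∀ c → ∣ c - 1 ∣ + (c ⊓ 1 + c ⊓ 1) ≡ c + 1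
    ∣c-1∣+2[c⊓1]≡c+1 zero    = refl
    ∣c-1∣+2[c⊓1]≡c+1 (suc c) rewrite ⊓-zeroʳ c | ∣-∣-identityʳ c = +-suc c 1
    S+2H≡L+k : S + (H + H) ≡ L + k
    S+2H≡L+k = begin-equality
      S + (H + H)                                   ≡⟨ cong (S +_) (∑-distrib-+ {k} (λ ρ → c ρ ⊓ 1) (λ ρ → c ρ ⊓ 1)) ⟨
      S + ∑[ ρ < k ] (c ρ ⊓ 1 + c ρ ⊓ 1)            ≡⟨ ∑-distrib-+ {k} (λ ρ → ∣ c ρ - 1 ∣) (λ ρ → c ρ ⊓ 1 + c ρ ⊓ 1) ⟨
      ∑[ ρ < k ] (∣ c ρ - 1 ∣ + (c ρ ⊓ 1 + c ρ ⊓ 1)) ≡⟨ sum-cong-≗ (∣c-1∣+2[c⊓1]≡c+1 ∘ c) ⟩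
      ∑[ ρ < k ] (c ρ + 1)                          ≡⟨ ∑-distrib-+ {k} c (λ _ → 1) ⟩
      ∑[ ρ < k ] c ρ + ∑[ ρ < k ] 1                 ≡⟨ cong₂ _+_ (∑-residueCount xs) (trans (∑-const k 1) (*-identityʳ k)) ⟩
      L + k                                         ∎

-- Spectra and the lower bound

degree : ∀ {N} → Graph N → Fin N → ℕ
degree G w = count (G w)

module _ {A : Set} (p : A → Bool) where

  length-filter-tabulate : ∀ {n} (f : Fin n → A) →
                           length (filter (λ a → p a Bool.≟ true) (tabulate f)) ≡ count (p ∘ f)
  length-filter-tabulate {zero}  f = refl
  length-filter-tabulate {suc n} f with p (f zero)
  ... | true  = cong suc (length-filter-tabulate (f ∘ suc))
  ... | false = length-filter-tabulate (f ∘ suc)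

  multiplicity-filter-tabulate : ∀ {n} (f : Fin n → A) (g : A → ℕ) c →
    multiplicity c (map g (filter (λ a → p a Bool.≟ true) (tabulate f))) ≡ count (λ i → p (f i) ∧ ⌊ g (f i) ℕ.≟ c ⌋)
  multiplicity-filter-tabulate {zero}  f g c = refl
  multiplicity-filter-tabulate {suc n} f g c with p (f zero)
  ... | true  = cong (indicator ⌊ g (f zero) ℕ.≟ c ⌋ +_) (multiplicity-filter-tabulate (f ∘ suc) g c)
  ... | false = multiplicity-filter-tabulate (f ∘ suc) g c

sum-map-tabulate : ∀ {A : Set} {n} (g : Fin n → A) (f : A → ℕ) → ListAction.sum (map f (tabulate g)) ≡ sum (f ∘ g)
sum-map-tabulate {n = zero}  g f = refl
sum-map-tabulate {n = suc n} g f = cong (f (g zero) +_) (sum-map-tabulate (g ∘ suc) f)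

defGraphCol≡∑defVertex : ∀ {N} (G : Graph N) α → defGraphCol G α ≡ ∑[ w < N ] defVertex G α w
defGraphCol≡∑defVertex G α = sum-map-tabulate (λ w → w) (defVertex G α)

length-spectrumList : ∀ {N} (G : Graph N) α w → length (spectrumList G α w) ≡ degree G w
length-spectrumList {N} G α w =
  trans (length-map (α w) (filter (λ x → G w x Bool.≟ true) (allFin N))) (length-filter-tabulate (G w) (λ x → x))

spectrumList-unique : ∀ {N t} {G : Graph N} {α} → IsProperTColoring G t α → ∀ w → Unique (spectrumList G α w)
spectrumList-unique {N} {G = G} {α} (_ , _ , _ , distinct) w =
  Unique-map⁺-injectiveOn (α w)
    (λ {x} {y} Gwx Gwy αx≡αy → decidable-stable (x Fin.≟ y) (λ x≢y → distinct w x y Gwx Gwy x≢y αx≡αy))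
    (Allₚ.all-filter (λ x → G w x Bool.≟ true) (allFin N))
    (Uniqueₚ.filter⁺ (λ x → G w x Bool.≟ true) (Uniqueₚ.allFin⁺ N))

∑degree-even : ∀ {N} (G : Graph N) → IsSimple G → ∃[ t ] ∑[ w < N ] degree G w ≡ 2 * t
∑degree-even {zero}  G _ = 0 , refl
∑degree-even {suc N} G (G-sym , G-irr)
  with ∑degree-even {N} (λ a b → G (suc a) (suc b)) ((λ a b → G-sym (suc a) (suc b)) , G-irr ∘ suc)
... | t , ∑deg′≡2t = c + t , (begin
  indicator (G zero zero) + c + ∑[ w < N ] (indicator (G (suc w) zero) + deg′ w)
    ≡⟨ cong₂ _+_ (cong (λ b → indicator b + c) (G-irr zero)) (∑-distrib-+ {N} (λ w → indicator (G (suc w) zero)) deg′) ⟩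
  c + (∑[ w < N ] indicator (G (suc w) zero) + ∑[ w < N ] deg′ w)
    ≡⟨ cong (λ x → c + (x + ∑[ w < N ] deg′ w)) (count-cong (λ w → G-sym (suc w) zero)) ⟩
  c + (c + ∑[ w < N ] deg′ w) ≡⟨ cong (λ x → c + (c + x)) ∑deg′≡2t ⟩
  c + (c + 2 * t)             ≡⟨ solve 2 (λ c t → c :+ (c :+ con 2 :* t) := con 2 :* (c :+ t)) refl c t ⟩
  2 * (c + t)                 ∎)
  where
  open ≡-Reasoning
  open +-*-Solver
  c = count (λ x → G zero (suc x))
  deg′ : Fin N → ℕ
  deg′ w = count (λ x → G (suc w) (suc x))

odd-order⇒1≤∑∣degree-1∣ : ∀ {N} q → N ≡ suc (2 * q) → (G : Graph N) → IsSimple G →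
                          1 ≤ ∑[ w < N ] ∣ degree G w - 1 ∣
odd-order⇒1≤∑∣degree-1∣ {N} q N≡2q+1 G simple
  with ∑degree-even G simple | ∑[ w < N ] ∣ degree G w - 1 ∣ in ∑∣deg-1∣≡
... | _           | suc _ = s≤s z≤n
... | t , ∑deg≡2t | zero  = ⊥-elim (even≢odd t q (begin
  2 * t                  ≡⟨ ∑deg≡2t ⟨
  ∑[ w < N ] degree G w  ≡⟨ sum-cong-≗ {N} (λ w → ∣m-n∣≡0⇒m≡n (∑≡0⇒≡0 (λ w → ∣ degree G w - 1 ∣) ∑∣deg-1∣≡ w)) ⟩
  ∑[ w < N ] 1           ≡⟨ ∑-const N 1 ⟩
  N * 1                  ≡⟨ *-identityʳ N ⟩
  N                      ≡⟨ N≡2q+1 ⟩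
  suc (2 * q)            ∎))
  where open ≡-Reasoning

residueSubgraph : ∀ {N} → Graph N → Coloring N → (k : ℕ) .{{_ : NonZero k}} → Fin k → Graph N
residueSubgraph G α k ρ i j = G i j ∧ ⌊ α i j % k ℕ.≟ toℕ ρ ⌋

residueSubgraph-simple : ∀ {N t} {G : Graph N} {α} → IsSimple G → IsProperTColoring G t α →
                         ∀ k .{{_ : NonZero k}} ρ → IsSimple (residueSubgraph G α k ρ)
residueSubgraph-simple {G = G} {α} (G-sym , G-irr) (α-sym , _) k ρ = R-sym , R-irr
  where
  R-sym : ∀ i j → residueSubgraph G α k ρ i j ≡ residueSubgraph G α k ρ j i
  R-sym i j with G i j in Gij
  ... | true  rewrite α-sym i j Gij | trans (sym (G-sym i j)) Gij = refl
  ... | false rewrite trans (sym (G-sym i j)) Gij = refl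
  R-irr : ∀ i → residueSubgraph G α k ρ i i ≡ false
  R-irr i rewrite G-irr i = refl

residueCount-spectrumList : ∀ {N} (G : Graph N) α k .{{_ : NonZero k}} w ρ →
  residueCount k (spectrumList G α w) ρ ≡ degree (residueSubgraph G α k ρ) w
residueCount-spectrumList {N} G α k w ρ =
  trans (cong (multiplicity (toℕ ρ)) (sym (map-∘ {g = _% k} {f = α w} (filter (λ x → G w x Bool.≟ true) (allFin N)))))
        (multiplicity-filter-tabulate (G w) (λ x → x) (λ x → α w x % k) (toℕ ρ))

module _ {N t : ℕ} {G : Graph N} {α : Coloring N} (simple : IsSimple G) (proper : IsProperTColoring G t α) where

  k+∑degree≤2*def+N*k : ∀ k .{{_ : NonZero k}} q → N ≡ suc (2 * q) → (∀ w → degree G w ≤ k) →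
                        k + ∑[ w < N ] degree G w ≤ 2 * defGraphCol G α + N * k
  k+∑degree≤2*def+N*k k q N≡2q+1 deg≤k = begin
    k + ∑deg                                 ≡⟨ cong (_+ ∑deg) (trans (sym (*-identityʳ k)) (sym (∑-const k 1))) ⟩
    ∑[ ρ < k ] 1 + ∑deg                      ≤⟨ +-monoˡ-≤ ∑deg (∑-mono-≤ {k} each-residue) ⟩
    ∑[ ρ < k ] ∑[ w < N ] ∣ c w ρ - 1 ∣ + ∑deg ≡⟨ cong (_+ ∑deg) (∑-comm {k} {N} (λ ρ w → ∣ c w ρ - 1 ∣)) ⟩
    ∑[ w < N ] ∑[ ρ < k ] ∣ c w ρ - 1 ∣ + ∑deg ≡⟨ ∑-distrib-+ {N} (λ w → ∑[ ρ < k ] ∣ c w ρ - 1 ∣) (degree G) ⟨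
    ∑[ w < N ] (∑[ ρ < k ] ∣ c w ρ - 1 ∣ + degree G w) ≤⟨ ∑-mono-≤ {N} each-vertex ⟩
    ∑[ w < N ] (2 * defVertex G α w + k)     ≡⟨ ∑-distrib-+ {N} (λ w → 2 * defVertex G α w) (λ _ → k) ⟩
    ∑[ w < N ] (2 * defVertex G α w) + ∑[ w < N ] k
      ≡⟨ cong₂ _+_ (trans (sym (*-distribˡ-sum 2 (defVertex G α))) (cong (2 *_) (sym (defGraphCol≡∑defVertex G α)))) (∑-const N k) ⟩
    2 * defGraphCol G α + N * k              ∎
    where
    open ≤-Reasoning
    ∑deg = ∑[ w < N ] degree G w
    c : Fin N → Fin k → ℕ
    c w = residueCount k (spectrumList G α w)
    each-residue : ∀ ρ → 1 ≤ ∑[ w < N ] ∣ c w ρ - 1 ∣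
    each-residue ρ = subst (1 ≤_) (sum-cong-≗ (λ w → cong ∣_- 1 ∣ (sym (residueCount-spectrumList G α k w ρ))))
      (odd-order⇒1≤∑∣degree-1∣ q N≡2q+1 (residueSubgraph G α k ρ) (residueSubgraph-simple simple proper k ρ))
    each-vertex : ∀ w → ∑[ ρ < k ] ∣ c w ρ - 1 ∣ + degree G w ≤ 2 * defVertex G α w + k
    each-vertex w = subst (λ L → ∑[ ρ < k ] ∣ c w ρ - 1 ∣ + L ≤ 2 * defVertex G α w + k) (length-spectrumList G α w)
      (∑∣residueCount-1∣ k (spectrumList G α w) (spectrumList-unique proper w)
                         (subst (_≤ k) (sym (length-spectrumList G α w)) (deg≤k w)))

-- The graph K_N − e

⌊≟⌋-sym : ∀ {n} (i j : Fin n) → ⌊ i Fin.≟ j ⌋ ≡ ⌊ j Fin.≟ i ⌋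
⌊≟⌋-sym i j with i Fin.≟ j
... | yes i≡j = sym (⌊⌋≡true (j Fin.≟ i) (sym i≡j))
... | no  i≢j = sym (⌊⌋≡false (j Fin.≟ i) (i≢j ∘ sym))

count-∧-≡ : ∀ {n} b (a : Fin n) → count (λ i → b ∧ ⌊ i Fin.≟ a ⌋) ≡ indicator b
count-∧-≡ true      a = count-≡ a
count-∧-≡ {n} false a = sum-replicate-zero n

at-most-one-endpoint : ∀ {n} {u v : Fin n} → u ≢ v → ∀ x → ⌊ x Fin.≟ u ⌋ ∧ ⌊ x Fin.≟ v ⌋ ≡ false
at-most-one-endpoint {u = u} {v} u≢v x with x Fin.≟ u
... | yes refl = ⌊⌋≡false (x Fin.≟ v) u≢v
... | no  _    = refl

KminusE-simple : ∀ {N} (u v : Fin N) → IsSimple (KminusE u v)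
KminusE-simple u v = K-sym , K-irr
  where
  K-sym : ∀ i j → KminusE u v i j ≡ KminusE u v j i
  K-sym i j = cong₂ (λ a b → not a ∧ not b) (⌊≟⌋-sym i j)
                    (trans (∨-comm (⌊ i Fin.≟ u ⌋ ∧ ⌊ j Fin.≟ v ⌋) _)
                           (cong₂ _∨_ (∧-comm ⌊ i Fin.≟ v ⌋ _) (∧-comm ⌊ i Fin.≟ u ⌋ _)))
  K-irr : ∀ i → KminusE u v i i ≡ false
  K-irr i rewrite ⌊⌋≡true (i Fin.≟ i) refl = refl

KminusE-removes-e : ∀ {N} (u v : Fin N) → KminusE u v u v ≡ false
KminusE-removes-e u v rewrite ⌊⌋≡true (u Fin.≟ u) refl | ⌊⌋≡true (v Fin.≟ v) refl = ∧-zeroʳ _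

endpointCount : ∀ {N} → Fin N → Fin N → Fin N → ℕ
endpointCount u v w = indicator ⌊ w Fin.≟ u ⌋ + indicator ⌊ w Fin.≟ v ⌋

∑endpointCount : ∀ {N} (u v : Fin N) → ∑[ w < N ] endpointCount u v w ≡ 2
∑endpointCount {N} u v = trans (∑-distrib-+ {N} (λ w → indicator ⌊ w Fin.≟ u ⌋) (λ w → indicator ⌊ w Fin.≟ v ⌋))
                               (cong₂ _+_ (count-≡ u) (count-≡ v))

degree-KminusE : ∀ {N} {u v : Fin N} → u ≢ v → ∀ w → degree (KminusE u v) w + endpointCount u v w + 1 ≡ N
degree-KminusE {N} {u} {v} u≢v w = begin
  deg + ep + 1                                  ≡⟨ solve 2 (λ d e → d :+ e :+ con 1 := con 1 :+ e :+ d) refl deg ep ⟩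
  1 + ep + deg                                  ≡⟨ cong₂ _+_ loop∨edge≡1+ep (count-cong (λ x → not-∨ (loop x) (edge x))) ⟨
  count loop∨edge + count (not ∘ loop∨edge)     ≡⟨ count+count-not loop∨edge ⟩
  N                                             ∎
  where
  open ≡-Reasoning
  open +-*-Solver
  deg = degree (KminusE u v) w
  ep  = endpointCount u v w
  loop edge loop∨edge : Fin N → Bool
  loop x = ⌊ w Fin.≟ x ⌋
  edge x = (⌊ w Fin.≟ u ⌋ ∧ ⌊ x Fin.≟ v ⌋) ∨ (⌊ w Fin.≟ v ⌋ ∧ ⌊ x Fin.≟ u ⌋)
  loop∨edge x = loop x ∨ edge x
  not-∨ : ∀ a b → not (a ∨ b) ≡ not a ∧ not b
  not-∨ true  _ = refl
  not-∨ false _ = refl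
  loop-disjoint : ∀ x → loop x ∧ edge x ≡ false
  loop-disjoint x with w Fin.≟ x
  ... | no  _    = refl
  ... | yes refl rewrite at-most-one-endpoint u≢v w | ∧-comm ⌊ w Fin.≟ v ⌋ ⌊ w Fin.≟ u ⌋
                       | at-most-one-endpoint u≢v w = refl
  edge-disjoint : ∀ x → (⌊ w Fin.≟ u ⌋ ∧ ⌊ x Fin.≟ v ⌋) ∧ (⌊ w Fin.≟ v ⌋ ∧ ⌊ x Fin.≟ u ⌋) ≡ false
  edge-disjoint x with w Fin.≟ u
  ... | no  _    = refl
  ... | yes refl rewrite ⌊⌋≡false (w Fin.≟ v) u≢v = ∧-zeroʳ _
  loop∨edge≡1+ep : count loop∨edge ≡ 1 + ep
  loop∨edge≡1+ep = begin
    count loop∨edge         ≡⟨ count-∨-disjoint loop edge loop-disjoint ⟩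
    count loop + count edge ≡⟨ cong₂ _+_ (trans (count-cong (⌊≟⌋-sym w)) (count-≡ w))
                                         (trans (count-∨-disjoint (λ x → ⌊ w Fin.≟ u ⌋ ∧ ⌊ x Fin.≟ v ⌋)
                                                                  (λ x → ⌊ w Fin.≟ v ⌋ ∧ ⌊ x Fin.≟ u ⌋) edge-disjoint)
                                                (cong₂ _+_ (count-∧-≡ ⌊ w Fin.≟ u ⌋ v) (count-∧-≡ ⌊ w Fin.≟ v ⌋ u))) ⟩
    1 + ep                  ∎

n∸1≤defGraphCol-KminusE : ∀ n (u v : Fin (2 * n + 1)) → u ≢ v → ∀ {t α} → IsProperTColoring (KminusE u v) t α →
                       n ∸ 1 ≤ defGraphCol (KminusE u v) α
n∸1≤defGraphCol-KminusE zero        _ _ _   _      = z≤n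
n∸1≤defGraphCol-KminusE n@(suc _) u v u≢v {α = α} proper = begin
  n ∸ 1       ≤⟨ ∸-monoˡ-≤ 1 (*-cancelˡ-≤ {n} {D + 1} 2 2n≤2[D+1]) ⟩
  D + 1 ∸ 1   ≡⟨ m+n∸n≡m D 1 ⟩
  D           ∎
  where
  open ≤-Reasoning
  N = 2 * n + 1
  G = KminusE u v
  D = defGraphCol G α
  ∑deg = ∑[ w < N ] degree G w
  deg+ep≡2n : ∀ w → degree G w + endpointCount u v w ≡ 2 * n
  deg+ep≡2n w = +-cancelʳ-≡ 1 _ _ (degree-KminusE u≢v w)
  ∑deg+2≡N*2n : ∑deg + 2 ≡ N * (2 * n)
  ∑deg+2≡N*2n = begin-equality
    ∑deg + 2                                       ≡⟨ cong (∑deg +_) (∑endpointCount u v) ⟨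
    ∑deg + ∑[ w < N ] endpointCount u v w          ≡⟨ ∑-distrib-+ {N} (degree G) (endpointCount u v) ⟨
    ∑[ w < N ] (degree G w + endpointCount u v w)  ≡⟨ sum-cong-≗ deg+ep≡2n ⟩
    ∑[ w < N ] (2 * n)                             ≡⟨ ∑-const N (2 * n) ⟩
    N * (2 * n)                                    ∎
  2n≤2[D+1] : 2 * n ≤ 2 * (D + 1)
  2n≤2[D+1] = +-cancelˡ-≤ ∑deg _ _ (begin
    ∑deg + 2 * n          ≡⟨ +-comm ∑deg (2 * n) ⟩
    2 * n + ∑deg          ≤⟨ k+∑degree≤2*def+N*k (KminusE-simple u v) proper (2 * n) n (+-comm (2 * n) 1)
                               (λ w → subst (degree G w ≤_) (deg+ep≡2n w) (m≤m+n _ _)) ⟩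
    2 * D + N * (2 * n)   ≡⟨ cong (2 * D +_) ∑deg+2≡N*2n ⟨
    2 * D + (∑deg + 2)    ≡⟨ solve 2 (λ D S → con 2 :* D :+ (S :+ con 2) := S :+ con 2 :* (D :+ con 1)) refl D ∑deg ⟩
    ∑deg + 2 * (D + 1)    ∎)
    where open +-*-Solver


-- An optimal colouring

m+m≡n+n⇒m≡n : ∀ {m n} → m + m ≡ n + n → m ≡ n
m+m≡n+n⇒m≡n {m} {n} e = trans (n≡⌊n+n/2⌋ m) (trans (cong ℕ.⌊_/2⌋ e) (sym (n≡⌊n+n/2⌋ n)))

m+m≢n+1+n : ∀ m n → m + m ≢ n + suc n
m+m≢n+1+n m n e = even≢odd m n (begin
  2 * m        ≡⟨ cong (m +_) (+-identityʳ m) ⟩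
  m + m        ≡⟨ e ⟩
  n + suc n    ≡⟨ +-suc n n ⟩
  suc (n + n)  ≡⟨ cong (λ x → suc (n + x)) (+-identityʳ n) ⟨
  suc (2 * n)  ∎)
  where open ≡-Reasoning

-- The ends u, v of the missing edge play the roles U and V, one more vertex plays Z and the
-- remaining 2m = 2n − 2 vertices play X s and Y s (1 ≤ s ≤ m). The spectra are the intervals
-- [1, 2n − 1] at U, [n + 1, 3n − 1] at V and [s + 1, s + 2n] at X s and Y s, while Z sees
-- [1, n] ∪ [2n, 3n − 1], whose gap of n − 1 colours is the entire deficiency.
-- The value of colour on non-adjacent roles is irrelevant.
data Role : Set where
  U V Z : Role
  X Y   : ℕ → Role

module Construction (m : ℕ) where

  open +-*-Solver

  n : ℕ
  n = suc m

  Valid : Role → Set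
  Valid (X s) = 1 ≤ s × s ≤ m
  Valid (Y s) = 1 ≤ s × s ≤ m
  Valid _     = ⊤

  Adjacent : Role → Role → Set
  Adjacent U     U     = ⊥
  Adjacent U     V     = ⊥
  Adjacent V     U     = ⊥
  Adjacent V     V     = ⊥
  Adjacent Z     Z     = ⊥
  Adjacent (X s) (X t) = s ≢ t
  Adjacent (Y s) (Y t) = s ≢ t
  Adjacent _     _     = ⊤

  colour : Role → Role → ℕ
  colour U     Z     = 1
  colour U     (X s) = s + s
  colour U     (Y s) = s + suc s
  colour V     Z     = n + n
  colour V     (X s) = s + n
  colour V     (Y s) = s + (n + n)
  colour Z     U     = 1
  colour Z     V     = n + n
  colour Z     (X s) = s + (n + n)
  colour Z     (Y s) = s + 1
  colour (X s) U     = s + s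
  colour (X s) V     = s + n
  colour (X s) Z     = s + (n + n)
  colour (X s) (X t) = s + t
  colour (X s) (Y t) = s + (t + n)
  colour (Y s) U     = s + suc s
  colour (Y s) V     = s + (n + n)
  colour (Y s) Z     = s + 1
  colour (Y s) (X t) = s + (t + n)
  colour (Y s) (Y t) = s + suc t
  colour _     _     = 0

  colour-sym : ∀ A B → colour A B ≡ colour B A
  colour-sym U     U     = refl
  colour-sym U     V     = refl
  colour-sym U     Z     = refl
  colour-sym U     (X t) = refl
  colour-sym U     (Y t) = refl
  colour-sym V     U     = refl
  colour-sym V     V     = refl
  colour-sym V     Z     = refl
  colour-sym V     (X t) = refl
  colour-sym V     (Y t) = refl
  colour-sym Z     U     = refl
  colour-sym Z     V     = refl
  colour-sym Z     Z     = refl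
  colour-sym Z     (X t) = refl
  colour-sym Z     (Y t) = refl
  colour-sym (X s) U     = refl
  colour-sym (X s) V     = refl
  colour-sym (X s) Z     = refl
  colour-sym (X s) (X t) = +-comm s t
  colour-sym (X s) (Y t) = solve 3 (λ s t n → s :+ (t :+ n) := t :+ (s :+ n)) refl s t n
  colour-sym (Y s) U     = refl
  colour-sym (Y s) V     = refl
  colour-sym (Y s) Z     = refl
  colour-sym (Y s) (X t) = solve 3 (λ s t n → s :+ (t :+ n) := t :+ (s :+ n)) refl s t n
  colour-sym (Y s) (Y t) = trans (+-suc s t) (trans (cong suc (+-comm s t)) (sym (+-suc t s)))

  private
    s<n : ∀ {s} → s ≤ m → s < n
    s<n = s≤s

    n<n+n : n < n + n
    n<n+n = m<m+n n (s≤s z≤n)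

    s+n<n+n : ∀ {s} → s ≤ m → s + n < n + n
    s+n<n+n s≤m = +-monoˡ-< n (s<n s≤m)

    n<s+n : ∀ {s} → 1 ≤ s → n < s + n
    n<s+n {s} 1≤s = m<n+m n 1≤s

    n+n<s+[n+n] : ∀ {s} → 1 ≤ s → n + n < s + (n + n)
    n+n<s+[n+n] 1≤s = m<n+m (n + n) 1≤s

    s+1<n+n : ∀ {s} → s ≤ m → s + 1 < n + n
    s+1<n+n {s} s≤m = ≤-<-trans (≤-trans (+-monoˡ-≤ 1 s≤m) (≤-reflexive (+-comm m 1))) n<n+n

    1<n+n : 1 < n + n
    1<n+n = ≤-<-trans (s≤s z≤n) n<n+n

  injective-at-U : ∀ {A B} → Valid A → Valid B → Adjacent U A → Adjacent U B → colour U A ≡ colour U B → A ≡ B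
  injective-at-U {U}   _          _          ()
  injective-at-U {V}   _          _          ()
  injective-at-U {B = U} _        _          _ ()
  injective-at-U {B = V} _        _          _ ()
  injective-at-U {Z}   {Z}   _ _          _ _ _ = refl
  injective-at-U {Z}   {X b} _ (1≤b , _) _ _ e = ⊥-elim (<⇒≢ (+-mono-≤ 1≤b 1≤b) e)
  injective-at-U {Z}   {Y b} _ (1≤b , _) _ _ e = ⊥-elim (<⇒≢ (+-mono-≤ 1≤b (s≤s z≤n)) e)
  injective-at-U {X a} {Z}   vA vB        _ _ e = sym (injective-at-U vB vA tt tt (sym e))
  injective-at-U {X a} {X b} _ _          _ _ e = cong X (m+m≡n+n⇒m≡n e)
  injective-at-U {X a} {Y b} _ _          _ _ e = ⊥-elim (m+m≢n+1+n a b e)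
  injective-at-U {Y a} {Z}   vA vB        _ _ e = sym (injective-at-U vB vA tt tt (sym e))
  injective-at-U {Y a} {X b} _ _          _ _ e = ⊥-elim (m+m≢n+1+n b a (sym e))
  injective-at-U {Y a} {Y b} _ _          _ _ e =
    cong Y (m+m≡n+n⇒m≡n (suc-injective (trans (sym (+-suc a a)) (trans e (+-suc b b)))))

  injective-at-V : ∀ {A B} → Valid A → Valid B → Adjacent V A → Adjacent V B → colour V A ≡ colour V B → A ≡ B
  injective-at-V {U}   _          _          ()
  injective-at-V {V}   _          _          ()
  injective-at-V {B = U} _        _          _ ()
  injective-at-V {B = V} _        _          _ ()
  injective-at-V {Z}   {Z}   _ _          _ _ _ = refl
  injective-at-V {Z}   {X b} _ (_ , b≤m) _ _ e = ⊥-elim (>⇒≢ (s+n<n+n b≤m) e)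
  injective-at-V {Z}   {Y b} _ (1≤b , _) _ _ e = ⊥-elim (<⇒≢ (n+n<s+[n+n] 1≤b) e)
  injective-at-V {X a} {Z}   vA vB        _ _ e = sym (injective-at-V vB vA tt tt (sym e))
  injective-at-V {X a} {X b} _ _          _ _ e = cong X (+-cancelʳ-≡ n a b e)
  injective-at-V {X a} {Y b} (_ , a≤m) _  _ _ e = ⊥-elim (<⇒≢ (<-≤-trans (s+n<n+n a≤m) (m≤n+m (n + n) b)) e)
  injective-at-V {Y a} {Z}   vA vB        _ _ e = sym (injective-at-V vB vA tt tt (sym e))
  injective-at-V {Y a} {X b} vA vB        _ _ e = sym (injective-at-V vB vA tt tt (sym e))
  injective-at-V {Y a} {Y b} _ _          _ _ e = cong Y (+-cancelʳ-≡ (n + n) a b e)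

  injective-at-Z : ∀ {A B} → Valid A → Valid B → Adjacent Z A → Adjacent Z B → colour Z A ≡ colour Z B → A ≡ B
  injective-at-Z {Z}   _          _          ()
  injective-at-Z {B = Z} _        _          _ ()
  injective-at-Z {U}   {U}   _ _          _ _ _ = refl
  injective-at-Z {U}   {V}   _ _          _ _ e = ⊥-elim (<⇒≢ 1<n+n e)
  injective-at-Z {U}   {X b} _ _          _ _ e = ⊥-elim (<⇒≢ (<-≤-trans 1<n+n (m≤n+m (n + n) b)) e)
  injective-at-Z {U}   {Y b} _ (1≤b , _) _ _ e = ⊥-elim (<⇒≢ (m<n+m 1 1≤b) e)
  injective-at-Z {V}   {U}   vA vB        _ _ e = sym (injective-at-Z vB vA tt tt (sym e))
  injective-at-Z {V}   {V}   _ _          _ _ _ = refl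
  injective-at-Z {V}   {X b} _ (1≤b , _) _ _ e = ⊥-elim (<⇒≢ (n+n<s+[n+n] 1≤b) e)
  injective-at-Z {V}   {Y b} _ (_ , b≤m) _ _ e = ⊥-elim (>⇒≢ (s+1<n+n b≤m) e)
  injective-at-Z {X a} {U}   vA vB        _ _ e = sym (injective-at-Z vB vA tt tt (sym e))
  injective-at-Z {X a} {V}   vA vB        _ _ e = sym (injective-at-Z vB vA tt tt (sym e))
  injective-at-Z {X a} {X b} _ _          _ _ e = cong X (+-cancelʳ-≡ (n + n) a b e)
  injective-at-Z {X a} {Y b} _ (_ , b≤m) _ _ e = ⊥-elim (>⇒≢ (<-≤-trans (s+1<n+n b≤m) (m≤n+m (n + n) a)) e)
  injective-at-Z {Y a} {U}   vA vB        _ _ e = sym (injective-at-Z vB vA tt tt (sym e))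
  injective-at-Z {Y a} {V}   vA vB        _ _ e = sym (injective-at-Z vB vA tt tt (sym e))
  injective-at-Z {Y a} {X b} vA vB        _ _ e = sym (injective-at-Z vB vA tt tt (sym e))
  injective-at-Z {Y a} {Y b} _ _          _ _ e = cong Y (+-cancelʳ-≡ 1 a b e)

  -- Every colour at X s or Y s has the form s + d, and d determines the neighbour.
  injective-at-X : ∀ s {A B} → Valid (X s) → Valid A → Valid B → Adjacent (X s) A → Adjacent (X s) B →
                   colour (X s) A ≡ colour (X s) B → A ≡ B
  injective-at-X s {U}   {U}   _         _ _ _ _   _ = refl
  injective-at-X s {U}   {V}   (_ , s≤m) _ _ _ _   e = ⊥-elim (<⇒≢ (s<n s≤m) (+-cancelˡ-≡ s _ _ e))
  injective-at-X s {U}   {Z}   (_ , s≤m) _ _ _ _   e = ⊥-elim (<⇒≢ (<-trans (s<n s≤m) n<n+n) (+-cancelˡ-≡ s _ _ e))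
  injective-at-X s {U}   {X b} _         _ _ _ s≢b e = ⊥-elim (s≢b (+-cancelˡ-≡ s _ _ e))
  injective-at-X s {U}   {Y b} (_ , s≤m) _ _ _ _   e = ⊥-elim (<⇒≢ (<-≤-trans (s<n s≤m) (m≤n+m n b)) (+-cancelˡ-≡ s _ _ e))
  injective-at-X s {V}   {U}   vT vA vB aA aB e = sym (injective-at-X s vT vB vA aB aA (sym e))
  injective-at-X s {V}   {V}   _ _ _ _ _ _ = refl
  injective-at-X s {V}   {Z}   _ _ _ _ _ e = ⊥-elim (<⇒≢ n<n+n (+-cancelˡ-≡ s _ _ e))
  injective-at-X s {V}   {X b} _ _ (_ , b≤m) _ _ e = ⊥-elim (>⇒≢ (s<n b≤m) (+-cancelˡ-≡ s _ _ e))
  injective-at-X s {V}   {Y b} _ _ (1≤b , _) _ _ e = ⊥-elim (<⇒≢ (n<s+n 1≤b) (+-cancelˡ-≡ s _ _ e))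
  injective-at-X s {Z}   {U}   vT vA vB aA aB e = sym (injective-at-X s vT vB vA aB aA (sym e))
  injective-at-X s {Z}   {V}   vT vA vB aA aB e = sym (injective-at-X s vT vB vA aB aA (sym e))
  injective-at-X s {Z}   {Z}   _ _ _ _ _ _ = refl
  injective-at-X s {Z}   {X b} _ _ (_ , b≤m) _ _ e = ⊥-elim (>⇒≢ (<-trans (s<n b≤m) n<n+n) (+-cancelˡ-≡ s _ _ e))
  injective-at-X s {Z}   {Y b} _ _ (_ , b≤m) _ _ e = ⊥-elim (>⇒≢ (s+n<n+n b≤m) (+-cancelˡ-≡ s _ _ e))
  injective-at-X s {X a} {U}   vT vA vB aA aB e = sym (injective-at-X s vT vB vA aB aA (sym e))
  injective-at-X s {X a} {V}   vT vA vB aA aB e = sym (injective-at-X s vT vB vA aB aA (sym e))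
  injective-at-X s {X a} {Z}   vT vA vB aA aB e = sym (injective-at-X s vT vB vA aB aA (sym e))
  injective-at-X s {X a} {X b} _ _ _ _ _ e = cong X (+-cancelˡ-≡ s _ _ e)
  injective-at-X s {X a} {Y b} _ (_ , a≤m) _ _ _ e = ⊥-elim (<⇒≢ (<-≤-trans (s<n a≤m) (m≤n+m n b)) (+-cancelˡ-≡ s _ _ e))
  injective-at-X s {Y a} {U}   vT vA vB aA aB e = sym (injective-at-X s vT vB vA aB aA (sym e))
  injective-at-X s {Y a} {V}   vT vA vB aA aB e = sym (injective-at-X s vT vB vA aB aA (sym e))
  injective-at-X s {Y a} {Z}   vT vA vB aA aB e = sym (injective-at-X s vT vB vA aB aA (sym e))
  injective-at-X s {Y a} {X b} vT vA vB aA aB e = sym (injective-at-X s vT vB vA aB aA (sym e))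
  injective-at-X s {Y a} {Y b} _ _ _ _ _ e = cong Y (+-cancelʳ-≡ n a b (+-cancelˡ-≡ s _ _ e))

  injective-at-Y : ∀ s {A B} → Valid (Y s) → Valid A → Valid B → Adjacent (Y s) A → Adjacent (Y s) B →
                   colour (Y s) A ≡ colour (Y s) B → A ≡ B
  injective-at-Y s {U}   {U}   _         _ _ _ _   _ = refl
  injective-at-Y s {U}   {V}   (_ , s≤m) _ _ _ _   e = ⊥-elim (<⇒≢ (≤-<-trans (s<n s≤m) n<n+n) (+-cancelˡ-≡ s _ _ e))
  injective-at-Y s {U}   {Z}   (1≤s , _) _ _ _ _   e = ⊥-elim (>⇒≢ (s≤s 1≤s) (+-cancelˡ-≡ s _ _ e))
  injective-at-Y s {U}   {X b} (_ , s≤m) _ (1≤b , _) _ _ e = ⊥-elim (<⇒≢ (≤-<-trans (s<n s≤m) (n<s+n 1≤b)) (+-cancelˡ-≡ s _ _ e))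
  injective-at-Y s {U}   {Y b} _         _ _ _ s≢b e = ⊥-elim (s≢b (suc-injective (+-cancelˡ-≡ s _ _ e)))
  injective-at-Y s {V}   {U}   vT vA vB aA aB e = sym (injective-at-Y s vT vB vA aB aA (sym e))
  injective-at-Y s {V}   {V}   _ _ _ _ _ _ = refl
  injective-at-Y s {V}   {Z}   _ _ _ _ _ e = ⊥-elim (>⇒≢ 1<n+n (+-cancelˡ-≡ s _ _ e))
  injective-at-Y s {V}   {X b} _ _ (_ , b≤m) _ _ e = ⊥-elim (>⇒≢ (s+n<n+n b≤m) (+-cancelˡ-≡ s _ _ e))
  injective-at-Y s {V}   {Y b} _ _ (_ , b≤m) _ _ e = ⊥-elim (>⇒≢ (≤-<-trans (s<n b≤m) n<n+n) (+-cancelˡ-≡ s _ _ e))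
  injective-at-Y s {Z}   {U}   vT vA vB aA aB e = sym (injective-at-Y s vT vB vA aB aA (sym e))
  injective-at-Y s {Z}   {V}   vT vA vB aA aB e = sym (injective-at-Y s vT vB vA aB aA (sym e))
  injective-at-Y s {Z}   {Z}   _ _ _ _ _ _ = refl
  injective-at-Y s {Z}   {X b} _ _ (1≤b , _) _ _ e = ⊥-elim (<⇒≢ (≤-<-trans (s≤s z≤n) (n<s+n 1≤b)) (+-cancelˡ-≡ s _ _ e))
  injective-at-Y s {Z}   {Y b} _ _ (1≤b , _) _ _ e = ⊥-elim (<⇒≢ (s≤s 1≤b) (+-cancelˡ-≡ s _ _ e))
  injective-at-Y s {X a} {U}   vT vA vB aA aB e = sym (injective-at-Y s vT vB vA aB aA (sym e))
  injective-at-Y s {X a} {V}   vT vA vB aA aB e = sym (injective-at-Y s vT vB vA aB aA (sym e))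
  injective-at-Y s {X a} {Z}   vT vA vB aA aB e = sym (injective-at-Y s vT vB vA aB aA (sym e))
  injective-at-Y s {X a} {X b} _ _ _ _ _ e = cong X (+-cancelʳ-≡ n a b (+-cancelˡ-≡ s _ _ e))
  injective-at-Y s {X a} {Y b} _ (1≤a , _) (_ , b≤m) _ _ e = ⊥-elim (>⇒≢ (≤-<-trans (s<n b≤m) (n<s+n 1≤a)) (+-cancelˡ-≡ s _ _ e))
  injective-at-Y s {Y a} {U}   vT vA vB aA aB e = sym (injective-at-Y s vT vB vA aB aA (sym e))
  injective-at-Y s {Y a} {V}   vT vA vB aA aB e = sym (injective-at-Y s vT vB vA aB aA (sym e))
  injective-at-Y s {Y a} {Z}   vT vA vB aA aB e = sym (injective-at-Y s vT vB vA aB aA (sym e))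
  injective-at-Y s {Y a} {X b} vT vA vB aA aB e = sym (injective-at-Y s vT vB vA aB aA (sym e))
  injective-at-Y s {Y a} {Y b} _ _ _ _ _ e = cong Y (suc-injective (+-cancelˡ-≡ s _ _ e))

  colour-injective : ∀ T {A B} → Valid T → Valid A → Valid B → Adjacent T A → Adjacent T B →
                     colour T A ≡ colour T B → A ≡ B
  colour-injective U     _  = injective-at-U
  colour-injective V     _  = injective-at-V
  colour-injective Z     _  = injective-at-Z
  colour-injective (X s) vT = injective-at-X s vT
  colour-injective (Y s) vT = injective-at-Y s vT

  minColour maxColour : Role → ℕ
  minColour U     = 1
  minColour V     = suc n
  minColour Z     = 1
  minColour (X s) = suc s
  minColour (Y s) = suc s
  maxColour U     = m + n
  maxColour V     = m + (n + n)
  maxColour Z     = m + (n + n)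
  maxColour (X s) = s + (n + n)
  maxColour (Y s) = s + (n + n)

  private
    shifted-window : ∀ s {d} → 1 ≤ d → d ≤ n + n → suc s ≤ s + d × s + d ≤ s + (n + n)
    shifted-window s {d} 1≤d d≤2n = subst (_≤ s + d) (+-comm s 1) (+-monoʳ-≤ s 1≤d) , +-monoʳ-≤ s d≤2n

    s≤n+n : ∀ {s} → s ≤ m → s ≤ n + n
    s≤n+n s≤m = <⇒≤ (<-trans (s<n s≤m) n<n+n)

    s+n≤n+n : ∀ {s} → s ≤ m → s + n ≤ n + n
    s+n≤n+n s≤m = <⇒≤ (s+n<n+n s≤m)

    ∸-cancel : ∀ {a b} → a ≡ b → a ∸ b ≡ 0
    ∸-cancel {b = b} refl = n∸n≡0 b

    1≤s+n : ∀ s → 1 ≤ s + n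
    1≤s+n s = ≤-trans (s≤s z≤n) (m≤n+m n s)

  colour-window : ∀ T A → Valid T → Valid A → Adjacent T A → minColour T ≤ colour T A × colour T A ≤ maxColour T
  colour-window U     Z     _ _ _ = ≤-refl , ≤-trans (s≤s z≤n) (m≤n+m n m)
  colour-window U     (X a) _ (1≤a , a≤m) _ = ≤-trans 1≤a (m≤m+n a a) , +-mono-≤ a≤m (<⇒≤ (s<n a≤m))
  colour-window U     (Y a) _ (_ , a≤m) _   = ≤-trans (s≤s z≤n) (m≤n+m (suc a) a) , +-mono-≤ a≤m (s<n a≤m)
  colour-window V     Z     _ _ _ = n<n+n , m≤n+m (n + n) m
  colour-window V     (X a) _ (1≤a , a≤m) _ = n<s+n 1≤a , +-mono-≤ a≤m (m≤m+n n n)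
  colour-window V     (Y a) _ (_ , a≤m) _   = <-≤-trans n<n+n (m≤n+m (n + n) a) , +-monoˡ-≤ (n + n) a≤m
  colour-window Z     U     _ _ _ = ≤-refl , ≤-trans (<⇒≤ 1<n+n) (m≤n+m (n + n) m)
  colour-window Z     V     _ _ _ = <⇒≤ 1<n+n , m≤n+m (n + n) m
  colour-window Z     (X a) _ (_ , a≤m) _   = ≤-trans (<⇒≤ 1<n+n) (m≤n+m (n + n) a) , +-monoˡ-≤ (n + n) a≤m
  colour-window Z     (Y a) _ (_ , a≤m) _   = m≤n+m 1 a , +-mono-≤ a≤m (<⇒≤ 1<n+n)
  colour-window (X s) U     (1≤s , s≤m) _ _ = shifted-window s 1≤s (s≤n+n s≤m)
  colour-window (X s) V     _ _ _           = shifted-window s (s≤s z≤n) (<⇒≤ n<n+n)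
  colour-window (X s) Z     _ _ _           = shifted-window s (<⇒≤ 1<n+n) ≤-refl
  colour-window (X s) (X a) _ (1≤a , a≤m) _ = shifted-window s 1≤a (s≤n+n a≤m)
  colour-window (X s) (Y a) _ (_ , a≤m) _   = shifted-window s (1≤s+n a) (s+n≤n+n a≤m)
  colour-window (Y s) U     (_ , s≤m) _ _   = shifted-window s (s≤s z≤n) (<⇒≤ (≤-<-trans (s<n s≤m) n<n+n))
  colour-window (Y s) V     _ _ _           = shifted-window s (<⇒≤ 1<n+n) ≤-refl
  colour-window (Y s) Z     _ _ _           = shifted-window s ≤-refl (<⇒≤ 1<n+n)
  colour-window (Y s) (X a) _ (_ , a≤m) _   = shifted-window s (1≤s+n a) (s+n≤n+n a≤m)
  colour-window (Y s) (Y a) _ (_ , a≤m) _   = shifted-window s (s≤s z≤n) (<⇒≤ (≤-<-trans (s<n a≤m) n<n+n))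

  colour-surjective : ∀ c → 1 ≤ c → c ≤ m + (n + n) →
                      ∃[ A ] ∃[ B ] (Valid A × Valid B × Adjacent A B × colour A B ≡ c)
  colour-surjective (suc zero)      _ _ = U , Z , tt , tt , tt , refl
  colour-surjective (suc c@(suc _)) _ 1+c≤t with c ≤? m
  ... | yes c≤m = Z , Y c , tt , (s≤s z≤n , c≤m) , tt , +-comm c 1
  ... | no  c≰m with suc c ∸ n ≤? m
  ...   | yes d≤m = V , X (suc c ∸ n) , tt , (m<n⇒0<n∸m (≰⇒> c≰m) , d≤m) , tt , m∸n+n≡m n≤1+c
    where n≤1+c = m≤n⇒m≤1+n (≰⇒> c≰m)
  ...   | no  d≰m with suc c ℕ.≟ n + n
  ...     | yes 1+c≡2n = V , Z , tt , tt , tt , sym 1+c≡2n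
  ...     | no  1+c≢2n = Z , X (suc c ∸ (n + n)) , tt , (m<n⇒0<n∸m 2n<1+c , d≤m) , tt , m∸n+n≡m (<⇒≤ 2n<1+c)
    where
    2n≤1+c : n + n ≤ suc c
    2n≤1+c = ≤-trans (+-monoˡ-≤ n (≰⇒> d≰m)) (≤-reflexive (m∸n+n≡m (m≤n⇒m≤1+n (≰⇒> c≰m))))
    2n<1+c : n + n < suc c
    2n<1+c = ≤∧≢⇒< 2n≤1+c (1+c≢2n ∘ sym)
    d≤m : suc c ∸ (n + n) ≤ m
    d≤m = ≤-trans (∸-monoˡ-≤ (n + n) 1+c≤t) (≤-reflexive (m+n∸n≡m m (n + n)))

  endpoints roleDegree roleDeficiency : Role → ℕ
  endpoints U = 1
  endpoints V = 1
  endpoints _ = 0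
  roleDegree U = m + n
  roleDegree V = m + n
  roleDegree _ = n + n
  roleDeficiency Z = m
  roleDeficiency _ = 0

  roleDegree+endpoints : ∀ T → roleDegree T + endpoints T ≡ n + n
  roleDegree+endpoints U     = +-comm (m + n) 1
  roleDegree+endpoints V     = +-comm (m + n) 1
  roleDegree+endpoints Z     = +-identityʳ (n + n)
  roleDegree+endpoints (X _) = +-identityʳ (n + n)
  roleDegree+endpoints (Y _) = +-identityʳ (n + n)

  window-deficiency : ∀ T → (maxColour T + 1) ∸ (minColour T + roleDegree T) ≡ roleDeficiency T
  window-deficiency U     = ∸-cancel (+-comm (m + n) 1)
  window-deficiency V     = ∸-cancel (solve 2 (λ m n → m :+ (n :+ n) :+ con 1 := con 1 :+ n :+ (m :+ n)) refl m n)
  window-deficiency Z     = trans (cong (_∸ (1 + (n + n))) (solve 2 (λ m n → m :+ (n :+ n) :+ con 1 := m :+ (con 1 :+ (n :+ n))) refl m n))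
                                  (m+n∸n≡m m (1 + (n + n)))
  window-deficiency (X s) = ∸-cancel (solve 2 (λ s n → s :+ (n :+ n) :+ con 1 := con 1 :+ s :+ (n :+ n)) refl s n)
  window-deficiency (Y s) = window-deficiency (X s)

  minColour≥1 : ∀ T → 1 ≤ minColour T
  minColour≥1 U     = ≤-refl
  minColour≥1 V     = s≤s z≤n
  minColour≥1 Z     = ≤-refl
  minColour≥1 (X _) = s≤s z≤n
  minColour≥1 (Y _) = s≤s z≤n

  maxColour≤ : ∀ T → Valid T → maxColour T ≤ m + (n + n)
  maxColour≤ U     _         = +-monoʳ-≤ m (m≤m+n n n)
  maxColour≤ V     _         = ≤-refl
  maxColour≤ Z     _         = ≤-refl
  maxColour≤ (X _) (_ , s≤m) = +-monoˡ-≤ (n + n) s≤m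
  maxColour≤ (Y _) (_ , s≤m) = +-monoˡ-≤ (n + n) s≤m

  adjacent-intro : ∀ A B → A ≢ B → ¬ (A ≡ U × B ≡ V) → ¬ (A ≡ V × B ≡ U) → Adjacent A B
  adjacent-intro U     U     A≢B _ _ = A≢B refl
  adjacent-intro U     V     _ ¬UV _ = ¬UV (refl , refl)
  adjacent-intro U     Z     _ _ _   = tt
  adjacent-intro U     (X _) _ _ _   = tt
  adjacent-intro U     (Y _) _ _ _   = tt
  adjacent-intro V     U     _ _ ¬VU = ¬VU (refl , refl)
  adjacent-intro V     V     A≢B _ _ = A≢B refl
  adjacent-intro V     Z     _ _ _   = tt
  adjacent-intro V     (X _) _ _ _   = tt
  adjacent-intro V     (Y _) _ _ _   = tt
  adjacent-intro Z     U     _ _ _   = tt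
  adjacent-intro Z     V     _ _ _   = tt
  adjacent-intro Z     Z     A≢B _ _ = A≢B refl
  adjacent-intro Z     (X _) _ _ _   = tt
  adjacent-intro Z     (Y _) _ _ _   = tt
  adjacent-intro (X _) U     _ _ _   = tt
  adjacent-intro (X _) V     _ _ _   = tt
  adjacent-intro (X _) Z     _ _ _   = tt
  adjacent-intro (X s) (X t) A≢B _ _ = A≢B ∘ cong X
  adjacent-intro (X _) (Y _) _ _ _   = tt
  adjacent-intro (Y _) U     _ _ _   = tt
  adjacent-intro (Y _) V     _ _ _   = tt
  adjacent-intro (Y _) Z     _ _ _   = tt
  adjacent-intro (Y _) (X _) _ _ _   = tt
  adjacent-intro (Y s) (Y t) A≢B _ _ = A≢B ∘ cong Y

  adjacent-irrefl : ∀ A → ¬ Adjacent A A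
  adjacent-irrefl U     ()
  adjacent-irrefl V     ()
  adjacent-irrefl Z     ()
  adjacent-irrefl (X s) s≢s = s≢s refl
  adjacent-irrefl (Y s) s≢s = s≢s refl

  encode : Role → ℕ
  encode U     = 0
  encode V     = 1
  encode Z     = 2
  encode (X s) = 2 + s
  encode (Y s) = 2 + (m + s)

  decode : ℕ → Role
  decode 0 = U
  decode 1 = V
  decode 2 = Z
  decode (suc (suc (suc c))) with c <? m
  ... | yes _ = X (suc c)
  ... | no  _ = Y (suc (c ∸ m))

  private
    n+n≡2+m+m : n + n ≡ 2 + (m + m)
    n+n≡2+m+m = cong suc (+-suc m m)

  decode-encode : ∀ A → Valid A → decode (encode A) ≡ A
  decode-encode U              _          = refl
  decode-encode V              _          = refl
  decode-encode Z              _          = refl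
  decode-encode (X zero)       (() , _)
  decode-encode (X (suc a))    (_ , a<m) with a <? m
  ... | yes _   = refl
  ... | no  a≮m = ⊥-elim (a≮m a<m)
  decode-encode (Y zero)       (() , _)
  decode-encode (Y (suc a))    _ rewrite +-suc m a with m + a <? m
  ... | yes m+a<m = ⊥-elim (m+n≮m m a m+a<m)
  ... | no  _     = cong (Y ∘ suc) (m+n∸m≡n m a)

  encode≤2n : ∀ A → Valid A → encode A ≤ n + n
  encode≤2n U     _         = z≤n
  encode≤2n V     _         = <⇒≤ 1<n+n
  encode≤2n Z     _         = 1<n+n
  encode≤2n (X s) (_ , s≤m) = ≤-trans (+-monoʳ-≤ 2 s≤m) n<n+n
  encode≤2n (Y s) (_ , s≤m) = ≤-trans (+-monoʳ-≤ 2 (+-monoʳ-≤ m s≤m)) (≤-reflexive (sym n+n≡2+m+m))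

  encode-surjective : ∀ c → c ≤ n + n → ∃[ A ] (Valid A × encode A ≡ c)
  encode-surjective 0 _ = U , tt , refl
  encode-surjective 1 _ = V , tt , refl
  encode-surjective 2 _ = Z , tt , refl
  encode-surjective (suc (suc (suc c))) c≤2n with c <? m
  ... | yes c<m = X (suc c) , (s≤s z≤n , c<m) , refl
  ... | no  c≮m = Y (suc (c ∸ m)) , (s≤s z≤n , c∸m<m) , cong (2 +_) (trans (+-suc m (c ∸ m)) (cong suc (m+[n∸m]≡n (≮⇒≥ c≮m))))
    where
    c<m+m : c < m + m
    c<m+m = ≤-pred (≤-pred (subst (suc (suc (suc c)) ≤_) n+n≡2+m+m c≤2n))
    c∸m<m : c ∸ m < m
    c∸m<m = subst (c ∸ m <_) (m+n∸m≡n m m) (∸-monoˡ-< c<m+m (≮⇒≥ c≮m))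

  decode-valid : ∀ c → c ≤ n + n → Valid (decode c)
  decode-valid c c≤2n with encode-surjective c c≤2n
  ... | A , vA , refl = subst Valid (sym (decode-encode A vA)) vA

  decode-injective : ∀ {c d} → c ≤ n + n → d ≤ n + n → decode c ≡ decode d → c ≡ d
  decode-injective {c} {d} c≤2n d≤2n e with encode-surjective c c≤2n | encode-surjective d d≤2n
  ... | A , vA , refl | B , vB , refl = cong encode (trans (sym (decode-encode A vA)) (trans e (decode-encode B vB)))

transpose-swaps : ∀ {n} (i j : Fin n) → PC.transpose i j i ≡ j
transpose-swaps i j rewrite dec-true (i Fin.≟ i) refl = refl

transpose-fixes : ∀ {n} {i j k : Fin n} → k ≢ i → k ≢ j → PC.transpose i j k ≡ k
transpose-fixes {i = i} {j} {k} k≢i k≢j rewrite dec-false (k Fin.≟ i) k≢i | dec-false (k Fin.≟ j) k≢j = refl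

module Labelling (m : ℕ) {u v : Fin (2 * suc m + 1)} (u≢v : u ≢ v) where

  open Construction m

  N : ℕ
  N = 2 * n + 1

  G : Graph N
  G = KminusE u v

  private
    N≡1+2n : N ≡ suc (n + n)
    N≡1+2n = trans (cong (λ k → n + k + 1) (+-identityʳ n)) (+-comm (n + n) 1)

    1<N : 1 < N
    1<N = subst (1 <_) (sym N≡1+2n) (s≤s (s≤s z≤n))

    one : Fin N
    one = fromℕ< 1<N

    v′ : Fin N
    v′ = PC.transpose u zero v

    v′≢zero : v′ ≢ zero
    v′≢zero v′≡0 = u≢v (begin
      u                                           ≡⟨ transpose-swaps zero u ⟨
      PC.transpose zero u zero                    ≡⟨ cong (PC.transpose zero u) v′≡0 ⟨
      PC.transpose zero u (PC.transpose u zero v) ≡⟨ PC.transpose-inverse zero u ⟩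
      v                                           ∎)
      where open ≡-Reasoning

  π : Permutation′ N
  π = transpose u zero ∘ₚ transpose v′ one

  π-u : π ⟨$⟩ʳ u ≡ zero
  π-u = trans (cong (PC.transpose v′ one) (transpose-swaps u zero))
              (transpose-fixes (v′≢zero ∘ sym) (λ 0≡1 → 0≢1+n (trans (cong toℕ 0≡1) (Finₚ.toℕ-fromℕ< 1<N))))

  π-v : π ⟨$⟩ʳ v ≡ one
  π-v = transpose-swaps v′ one

  role : Fin N → Role
  role w = decode (toℕ (π ⟨$⟩ʳ w))

  private
    code≤2n : ∀ w → toℕ (π ⟨$⟩ʳ w) ≤ n + n
    code≤2n w = ≤-pred (subst (toℕ (π ⟨$⟩ʳ w) <_) N≡1+2n (Finₚ.toℕ<n (π ⟨$⟩ʳ w)))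

  role-valid : ∀ w → Valid (role w)
  role-valid w = decode-valid _ (code≤2n w)

  role-injective : ∀ {i j} → role i ≡ role j → i ≡ j
  role-injective {i} {j} e = begin
    i                     ≡⟨ inverseˡ π {i} ⟨
    π ⟨$⟩ˡ (π ⟨$⟩ʳ i)     ≡⟨ cong (π ⟨$⟩ˡ_) (Finₚ.toℕ-injective (decode-injective (code≤2n i) (code≤2n j) e)) ⟩
    π ⟨$⟩ˡ (π ⟨$⟩ʳ j)     ≡⟨ inverseˡ π {j} ⟩
    j                     ∎
    where open ≡-Reasoning

  role-u : role u ≡ U
  role-u = cong (decode ∘ toℕ) π-u

  role-v : role v ≡ V
  role-v = trans (cong (decode ∘ toℕ) π-v) (cong decode (Finₚ.toℕ-fromℕ< 1<N))

  role-surjective : ∀ A → Valid A → ∃[ w ] role w ≡ A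
  role-surjective A vA = π ⟨$⟩ˡ k , (begin
    decode (toℕ (π ⟨$⟩ʳ (π ⟨$⟩ˡ k))) ≡⟨ cong (decode ∘ toℕ) (inverseʳ π {k}) ⟩
    decode (toℕ k)                    ≡⟨ cong decode (Finₚ.toℕ-fromℕ< encode<N) ⟩
    decode (encode A)                 ≡⟨ decode-encode A vA ⟩
    A                                 ∎)
    where
    open ≡-Reasoning
    encode<N : encode A < N
    encode<N = subst (encode A <_) (sym N≡1+2n) (s≤s (encode≤2n A vA))
    k = fromℕ< encode<N

  KminusE⇒Adjacent : ∀ {i j} → G i j ≡ true → Adjacent (role i) (role j)
  KminusE⇒Adjacent {i} {j} Gij = adjacent-intro (role i) (role j) distinct not-uv not-vu
    where
    G-sym = proj₁ (KminusE-simple u v)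
    G-irr = proj₂ (KminusE-simple u v)
    distinct : role i ≢ role j
    distinct e with role-injective {i} {j} e
    ... | refl = contradiction (trans (sym Gij) (G-irr i)) λ ()
    not-uv : ¬ (role i ≡ U × role j ≡ V)
    not-uv (iU , jV) with role-injective {i} {u} (trans iU (sym role-u)) | role-injective {j} {v} (trans jV (sym role-v))
    ... | refl | refl = contradiction (trans (sym Gij) (KminusE-removes-e u v)) λ ()
    not-vu : ¬ (role i ≡ V × role j ≡ U)
    not-vu (iV , jU) with role-injective {i} {v} (trans iV (sym role-v)) | role-injective {j} {u} (trans jU (sym role-u))
    ... | refl | refl = contradiction (trans (sym Gij) (trans (G-sym v u) (KminusE-removes-e u v))) λ ()

  Adjacent⇒KminusE : ∀ {i j} → Adjacent (role i) (role j) → G i j ≡ true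
  Adjacent⇒KminusE {i} {j} adj =
    cong₂ (λ a b → not a ∧ not b) (⌊⌋≡false (i Fin.≟ j) i≢j)
          (cong₂ _∨_ (⌊⌋∧⌊⌋≡false (i Fin.≟ u) (j Fin.≟ v) not-uv) (⌊⌋∧⌊⌋≡false (i Fin.≟ v) (j Fin.≟ u) not-vu))
    where
    i≢j : i ≢ j
    i≢j refl = adjacent-irrefl (role i) adj
    not-uv : ¬ (i ≡ u × j ≡ v)
    not-uv (refl , refl) = subst₂ Adjacent role-u role-v adj
    not-vu : ¬ (i ≡ v × j ≡ u)
    not-vu (refl , refl) = subst₂ Adjacent role-v role-u adj

  t : ℕ
  t = m + (n + n)

  α : Coloring N
  α i j = colour (role i) (role j)

  α-proper : IsProperTColoring G t α
  α-proper = (λ i j _ → colour-sym (role i) (role j)) , in-range , surjective , distinct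
    where
    window : ∀ {i j} → G i j ≡ true → minColour (role i) ≤ α i j × α i j ≤ maxColour (role i)
    window {i} {j} Gij = colour-window (role i) (role j) (role-valid i) (role-valid j) (KminusE⇒Adjacent {i} {j} Gij)
    in-range : ∀ i j → G i j ≡ true → 1 ≤ α i j × α i j ≤ m + (n + n)
    in-range i j Gij = ≤-trans (minColour≥1 (role i)) (proj₁ (window {i} {j} Gij))
                     , ≤-trans (proj₂ (window {i} {j} Gij)) (maxColour≤ (role i) (role-valid i))
    surjective : ∀ c → 1 ≤ c → c ≤ m + (n + n) → ∃[ i ] ∃[ j ] (G i j ≡ true × α i j ≡ c)
    surjective c 1≤c c≤t with colour-surjective c 1≤c c≤t
    ... | A , B , vA , vB , adj , AB≡c with role-surjective A vA | role-surjective B vB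
    ...   | i , refl | j , refl = i , j , Adjacent⇒KminusE {i} {j} adj , AB≡c
    distinct : ∀ i j k → G i j ≡ true → G i k ≡ true → j ≢ k → α i j ≢ α i k
    distinct i j k Gij Gik j≢k e = j≢k (role-injective {j} {k}
      (colour-injective (role i) (role-valid i) (role-valid j) (role-valid k) (KminusE⇒Adjacent {i} {j} Gij) (KminusE⇒Adjacent {i} {k} Gik) e))

  private
    endpointCount-≡ : ∀ w {a b} → ⌊ w Fin.≟ u ⌋ ≡ a → ⌊ w Fin.≟ v ⌋ ≡ b → endpointCount u v w ≡ indicator a + indicator b
    endpointCount-≡ w = cong₂ (λ a b → indicator a + indicator b)

    endpointCount-other : ∀ w → role w ≢ U → role w ≢ V → endpointCount u v w ≡ 0
    endpointCount-other w w≢U w≢V = endpointCount-≡ w (⌊⌋≡false (w Fin.≟ u) (λ w≡u → w≢U (trans (cong role w≡u) role-u)))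
                                                      (⌊⌋≡false (w Fin.≟ v) (λ w≡v → w≢V (trans (cong role w≡v) role-v)))

  endpointCount-role : ∀ w → endpointCount u v w ≡ endpoints (role w)
  endpointCount-role w with role w in role-w
  ... | U   = endpointCount-≡ w (⌊⌋≡true (w Fin.≟ u) w≡u) (⌊⌋≡false (w Fin.≟ v) (u≢v ∘ trans (sym w≡u)))
    where w≡u = role-injective {w} {u} (trans role-w (sym role-u))
  ... | V   = endpointCount-≡ w (⌊⌋≡false (w Fin.≟ u) (u≢v ∘ sym ∘ trans (sym w≡v))) (⌊⌋≡true (w Fin.≟ v) w≡v)
    where w≡v = role-injective {w} {v} (trans role-w (sym role-v))
  ... | Z   = endpointCount-other w (λ e → contradiction (trans (sym role-w) e) λ ()) (λ e → contradiction (trans (sym role-w) e) λ ())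
  ... | X _ = endpointCount-other w (λ e → contradiction (trans (sym role-w) e) λ ()) (λ e → contradiction (trans (sym role-w) e) λ ())
  ... | Y _ = endpointCount-other w (λ e → contradiction (trans (sym role-w) e) λ ()) (λ e → contradiction (trans (sym role-w) e) λ ())

  degree-role : ∀ w → degree G w ≡ roleDegree (role w)
  degree-role w = +-cancelʳ-≡ (endpoints (role w)) _ _ (suc-injective (begin
    suc (degree G w + endpoints (role w))    ≡⟨ cong (λ e → suc (degree G w + e)) (endpointCount-role w) ⟨
    suc (degree G w + endpointCount u v w)   ≡⟨ +-comm 1 _ ⟩
    degree G w + endpointCount u v w + 1     ≡⟨ degree-KminusE u≢v w ⟩
    N                                        ≡⟨ N≡1+2n ⟩
    suc (n + n)                              ≡⟨ cong suc (roleDegree+endpoints (role w)) ⟨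
    suc (roleDegree (role w) + endpoints (role w)) ∎))
    where open ≡-Reasoning

  defVertex≤roleDeficiency : ∀ w → defVertex G α w ≤ roleDeficiency (role w)
  defVertex≤roleDeficiency w = begin
    defSet (spectrumList G α w)                       ≤⟨ defSet-≤ _ (spectrumList-unique α-proper w) in-window ⟩
    (maxColour T + 1) ∸ (minColour T + length (spectrumList G α w))
      ≡⟨ cong (λ d → (maxColour T + 1) ∸ (minColour T + d)) (trans (length-spectrumList G α w) (degree-role w)) ⟩
    (maxColour T + 1) ∸ (minColour T + roleDegree T) ≡⟨ window-deficiency T ⟩
    roleDeficiency T                                  ∎
    where
    open ≤-Reasoning
    T = role w
    in-window : All (λ c → minColour T ≤ c × c ≤ maxColour T) (spectrumList G α w)
    in-window = Allₚ.map⁺ (All.map (λ {x} Gwx → colour-window T (role x) (role-valid w) (role-valid x) (KminusE⇒Adjacent {w} {x} Gwx))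
                                   (Allₚ.all-filter (λ x → G w x Bool.≟ true) (allFin N)))

  defGraphCol≤m : defGraphCol G α ≤ m
  defGraphCol≤m = begin
    defGraphCol G α                       ≡⟨ defGraphCol≡∑defVertex G α ⟩
    ∑[ w < N ] defVertex G α w            ≤⟨ ∑-mono-≤ {N} defVertex≤roleDeficiency ⟩
    ∑[ w < N ] roleDeficiency (role w)    ≡⟨ ∑-single {N} (roleDeficiency ∘ role) z others-zero ⟩
    roleDeficiency (role z)               ≡⟨ cong roleDeficiency role-z ⟩
    m                                     ∎
    where
    open ≤-Reasoning
    z = proj₁ (role-surjective Z tt)
    role-z = proj₂ (role-surjective Z tt)
    others-zero : ∀ w → w ≢ z → roleDeficiency (role w) ≡ 0
    others-zero w w≢z with role w in role-w
    ... | U   = refl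
    ... | V   = refl
    ... | Z   = contradiction (role-injective {w} {z} (trans role-w (sym role-z))) w≢z
    ... | X _ = refl
    ... | Y _ = refl


theorem3p2 : (n : ℕ) → 1 ≤ n → (u v : Fin (2 * n + 1)) → u ≢ v →
    IsDeficiency (KminusE u v) (n ∸ 1)
theorem3p2 zero    ()
theorem3p2 (suc m) _ u v u≢v =
  (t , α , α-proper , ≤-antisym defGraphCol≤m (n∸1≤defGraphCol-KminusE (suc m) u v u≢v α-proper)) ,
  λ _ _ proper → n∸1≤defGraphCol-KminusE (suc m) u v u≢v proper
  where open Labelling m u≢v
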